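{- For the simple, diagonal, king, or diabolo model, the series $P(x,y)$, $L(x,y)$, $B(x,y)$ defined in the context satisfy \[ P(x,y)=\bar x\big(L(x,y)-L(0,y)\big)+\bar y\big(B(x,y)-B(x,0)\big). \]
   Context: The four step sets are: simple $\{(1,0),(0,1),(-1,0),(0,-1)\}$; diagonal $\{(1,1),(-1,1),(-1,-1),(1,-1)\}$; king $\{ -1,0,1\}^2\setminus\{(0,0)\}$; diabolo $\{(1,0),(1,1),(-1,1),(-1,0),(-1,-1),(1,-1)\}$. $\mathcal Q=\{(i,j):i,j\ge0\}$, $\mathcal C=\{(i,j)\in\mathbb Z^2:i\ge0\text{ or }j\ge0\}$; a walk is confined to $\mathcal C$ if all its vertices lie in $\mathcal C$ and it uses no step between $(-1,0)$ and $(0,-1)$. $C(x,y)=\sum x^iy^jt^n$ over walks from $(0,0)$ confined to $\mathcal C$ ($(i,j)$ endpoint, $n$ length), and $Q(x,y)$ likewise for walks from $(0,0)$ with all vertices in $\mathcal Q$. $\bar x=1/x$, $\bar y=1/y$. Let $A(x,y)=C(x,y)-\frac13\big(Q(x,y)-\bar x^2Q(\bar x,y)-\bar y^2Q(x,\bar y)\big)$, and let $P,L,B\in\mathbb Q[x,y][[t]]$ be the unique series with $A(x,y)=P(x,y)+\bar xL(\bar x,y)+\bar yB(x,\bar y)$. -}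

module Defs where

open import Data.Nat using (ℕ; zero; suc)
open import Data.Integer as ℤ using (ℤ; +_; -[1+_]; 0ℤ; 1ℤ)
open import Data.Rational as ℚ using (ℚ; 0ℚ)
open import Data.Product using (_×_; _,_)
open import Data.List using (List; []; _∷_; map; concatMap; filter; length)
open import Data.Bool using (Bool; true; false; _∧_; _∨_; not; if_then_else_)
open import Relation.Nullary.Decidable using (does; ⌊_⌋)
open import Relation.Binary.PropositionalEquality using (_≡_)

Pt : Set
Pt = ℤ × ℤ

_==ℤ_ : ℤ → ℤ → Bool
a ==ℤ b = does (a ℤ.≟ b)

_==P_ : Pt → Pt → Bool
(a , b) ==P (c , d) = (a ==ℤ c) ∧ (b ==ℤ d)

nonneg : ℤ → Bool
nonneg i = does (0ℤ ℤ.≤? i)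

data Model : Set where
  simple diagonal king diabolo : Model

m1 : ℤ
m1 = -[1+ 0 ]

steps : Model → List Pt
steps simple   = (1ℤ , 0ℤ) ∷ (0ℤ , 1ℤ) ∷ (m1 , 0ℤ) ∷ (0ℤ , m1) ∷ []
steps diagonal = (1ℤ , 1ℤ) ∷ (m1 , 1ℤ) ∷ (m1 , m1) ∷ (1ℤ , m1) ∷ []
steps king     = (1ℤ , 0ℤ) ∷ (1ℤ , 1ℤ) ∷ (0ℤ , 1ℤ) ∷ (m1 , 1ℤ)
               ∷ (m1 , 0ℤ) ∷ (m1 , m1) ∷ (0ℤ , m1) ∷ (1ℤ , m1) ∷ []
steps diabolo  = (1ℤ , 0ℤ) ∷ (1ℤ , 1ℤ) ∷ (m1 , 1ℤ) ∷ (m1 , 0ℤ)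
               ∷ (m1 , m1) ∷ (1ℤ , m1) ∷ []

allWalks : List Pt → ℕ → List (List Pt)
allWalks S zero    = [] ∷ []
allWalks S (suc n) = concatMap (λ s → map (s ∷_) (allWalks S n)) S

_+P_ : Pt → Pt → Pt
(a , b) +P (c , d) = (a ℤ.+ c , b ℤ.+ d)

vertices : Pt → List Pt → List Pt
vertices p []      = p ∷ []
vertices p (s ∷ w) = p ∷ vertices (p +P s) w

endpoint : Pt → List Pt → Pt
endpoint p []      = p
endpoint p (s ∷ w) = endpoint (p +P s) w

allB : (Pt → Bool) → List Pt → Bool
allB f []      = true
allB f (x ∷ xs) = f x ∧ allB f xs

inQ : Pt → Bool
inQ (i , j) = nonneg i ∧ nonneg j

inC : Pt → Bool
inC (i , j) = nonneg i ∨ nonneg j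

badEdge : Pt → Pt → Bool
badEdge u v = ((u ==P (m1 , 0ℤ)) ∧ (v ==P (0ℤ , m1)))
            ∨ ((u ==P (0ℤ , m1)) ∧ (v ==P (m1 , 0ℤ)))

noBadEdge : Pt → List Pt → Bool
noBadEdge p []      = true
noBadEdge p (s ∷ w) = not (badEdge p (p +P s)) ∧ noBadEdge (p +P s) w

origin : Pt
origin = (0ℤ , 0ℤ)

confinedC : List Pt → Bool
confinedC w = allB inC (vertices origin w) ∧ noBadEdge origin w

confinedQ : List Pt → Bool
confinedQ w = allB inQ (vertices origin w)

count : (List Pt → Bool) → List (List Pt) → ℕ
count f []       = 0
count f (w ∷ ws) = if f w then suc (count f ws) else count f ws

-- Series in ℚ[x, x̄, y, ȳ][[t]] represented by their coefficients:
-- F n i j = [t^n x^i y^j] F.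
LSeries : Set
LSeries = ℕ → ℤ → ℤ → ℚ

-- Series in ℚ[x,y][[t]]: S n a b = [t^n x^a y^b] S, a b ≥ 0.
Series : Set
Series = ℕ → ℕ → ℕ → ℚ

embed : Series → LSeries
embed S n (+ a) (+ b) = S n a b
embed S n _     _     = 0ℚ

_⊕_ : LSeries → LSeries → LSeries
(F ⊕ G) n i j = F n i j ℚ.+ G n i j

_⊖_ : LSeries → LSeries → LSeries
(F ⊖ G) n i j = F n i j ℚ.- G n i j

scale : ℚ → LSeries → LSeries
scale c F n i j = c ℚ.* F n i j

xbar· : LSeries → LSeries
xbar· F n i j = F n (i ℤ.+ 1ℤ) j

ybar· : LSeries → LSeries
ybar· F n i j = F n i (j ℤ.+ 1ℤ)

substX̄ : LSeries → LSeries
substX̄ F n i j = F n (ℤ.- i) j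

substȲ : LSeries → LSeries
substȲ F n i j = F n i (ℤ.- j)

-- substitutions x ↦ 0 and y ↦ 0 (for series without negative powers)
atX0 : LSeries → LSeries
atX0 F n i j = if i ==ℤ 0ℤ then F n 0ℤ j else 0ℚ

atY0 : LSeries → LSeries
atY0 F n i j = if j ==ℤ 0ℤ then F n i 0ℤ else 0ℚ

natℚ : ℕ → ℚ
natℚ k = (+ k) ℚ./ 1

Cser : Model → LSeries
Cser m n i j = natℚ (count (λ w → confinedC w ∧ (endpoint origin w ==P (i , j)))
                           (allWalks (steps m) n))

Qser : Model → LSeries
Qser m n i j = natℚ (count (λ w → confinedQ w ∧ (endpoint origin w ==P (i , j)))
                           (allWalks (steps m) n))

Aser : Model → LSeries
Aser m = Cser m ⊖ scale ((+ 1) ℚ./ 3)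
           ((Qser m ⊖ xbar· (xbar· (substX̄ (Qser m))))
                    ⊖ ybar· (ybar· (substȲ (Qser m))))

_≈S_ : LSeries → LSeries → Set
F ≈S G = ∀ n i j → F n i j ≡ G n i j

IsDecomposition : Model → Series → Series → Series → Set
IsDecomposition m P L B =
  Aser m ≈S ((embed P ⊕ xbar· (substX̄ (embed L))) ⊕ ybar· (substȲ (embed B)))

-- Write C_n(q), Q_n(q) for the numbers of n-step walks from the origin to q confined to 𝒞, resp. 𝒬,
-- and let ρ₁(i,j) = (-2-i, j), ρ₂(i,j) = (i, -2-j) be the reflections in the lines x = -1, y = -1.
-- The key fact is the reflection identity C_n(q) = Q_n(q) + C_n(ρ₁ q) + C_n(ρ₂ q) for q ∈ 𝒬, proved
-- by induction on n by removing the last step.  Each step set is symmetric in both axes, so the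
-- last-step recursion commutes with ρ₁ and ρ₂; on the lines x = -1 and y = -1, each fixed by one of
-- the reflections, the identity is trivial because Q_n and the other reflected term vanish there.
-- Substituted into A = C - ⅓(Q - x̄²Q(x̄,y) - ȳ²Q(x,ȳ)) it gives [x^a y^b]A = [x^(-a-2) y^b]A +
-- [x^a y^(-b-2)]A, and reading these coefficients off A = P + x̄L(x̄,y) + ȳB(x,ȳ) yields
-- P_(a,b) = L_(a+1,b) + B_(a,b+1), which is the claimed identity coefficientwise.

module Submission where

open import Level using (Level)
open import Function using (_∘_; case_of_)
open import Data.Bool using (Bool; true; false; _∧_; _∨_; not; if_then_else_)
open import Data.Bool.Properties using (∧-zeroʳ; ∧-identityʳ; ∨-identityʳ; if-eta; if-swap-then)
open import Data.Product using (_×_; _,_)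
open import Data.Product.Properties using (≡-dec)
open import Data.Nat as ℕ using (ℕ; zero; suc; _+_)
import Data.Nat.Properties as ℕ
import Data.Nat.Coprimality as Coprime
open import Data.Nat.ListAction using (sum)
open import Data.Nat.ListAction.Properties using (sum-↭)
open import Algebra.Properties.CommutativeSemigroup ℕ.+-commutativeSemigroup using (interchange)
open import Data.Integer as ℤ using (ℤ; +_; -[1+_]; 0ℤ; 1ℤ; -1ℤ)
import Data.Integer.Properties as ℤ
open import Data.Integer.Tactic.RingSolver using (solve-∀)
open import Data.Rational as ℚ using (ℚ; 0ℚ; mkℚ)
import Data.Rational.Properties as ℚ
import Data.Rational.Unnormalised as ℚᵘ
import Data.Rational.Unnormalised.Properties as ℚᵘ
open import Data.Rational.Solver using (module +-*-Solver)
open import Data.List using (List; []; _∷_; map; concatMap; _++_; take; drop; reverse)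
open import Data.List.Properties using (map-∘; map-cong; map-cong-local; take++drop≡id)
open import Data.List.Relation.Unary.All as All using (All; all?)
open import Data.List.Relation.Binary.Permutation.Propositional using (_↭_; ↭-trans; ↭-sym; ↭-reflexive)
import Data.List.Relation.Binary.Permutation.Propositional.Properties as ↭
open import Relation.Binary.Definitions using (DecidableEquality)
open import Relation.Binary.PropositionalEquality
open import Relation.Nullary.Decidable using (Dec; yes; no; from-yes; dec-true; _×-dec_)
open import Relation.Nullary.Negation using (contradiction)

open import Defs

private
  variable
    ℓ ℓ′ : Level
    A : Set ℓ
    B : Set ℓ′

sum-map-+ : ∀ (f g : A → ℕ) xs →
  sum (map (λ x → f x + g x) xs) ≡ sum (map f xs) + sum (map g xs)
sum-map-+ f g []       = refl
sum-map-+ f g (x ∷ xs) = trans (cong (λ s → f x + g x + s) (sum-map-+ f g xs))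
                               (interchange (f x) (g x) _ _)

sum-map-zero : ∀ (xs : List A) → sum (map (λ _ → 0) xs) ≡ 0
sum-map-zero []       = refl
sum-map-zero (x ∷ xs) = sum-map-zero xs

sum-map-comm : ∀ (h : A → B → ℕ) xs ys →
  sum (map (λ x → sum (map (h x) ys)) xs) ≡ sum (map (λ y → sum (map (λ x → h x y) xs)) ys)
sum-map-comm h []       ys = sym (sum-map-zero ys)
sum-map-comm h (x ∷ xs) ys =
  trans (cong (λ s → sum (map (h x) ys) + s) (sum-map-comm h xs ys))
        (sym (sum-map-+ (h x) (λ y → sum (map (λ x → h x y) xs)) ys))

if-sum-map : ∀ c (f : A → ℕ) xs →
  (if c then sum (map f xs) else 0) ≡ sum (map (λ x → if c then f x else 0) xs)
if-sum-map true  f xs = refl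
if-sum-map false f xs = sym (sum-map-zero xs)

sum-map-invariant : ∀ (f : A → A) (h : A → ℕ) xs →
  map f xs ↭ xs → sum (map (h ∘ f) xs) ≡ sum (map h xs)
sum-map-invariant f h xs f-permutes =
  trans (cong sum (map-∘ xs)) (sum-↭ (↭.map⁺ h f-permutes))

count-++ : ∀ (f : List Pt → Bool) xs ys → count f (xs ++ ys) ≡ count f xs + count f ys
count-++ f []       ys = refl
count-++ f (x ∷ xs) ys with f x
... | true  = cong suc (count-++ f xs ys)
... | false = count-++ f xs ys

count-map : ∀ (f : List Pt → Bool) (g : List Pt → List Pt) xs → count f (map g xs) ≡ count (f ∘ g) xs
count-map f g []       = refl
count-map f g (x ∷ xs) with f (g x)
... | true  = cong suc (count-map f g xs)
... | false = count-map f g xs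

count-cong : ∀ {f g : List Pt → Bool} xs → (∀ x → f x ≡ g x) → count f xs ≡ count g xs
count-cong []       f≗g = refl
count-cong (x ∷ xs) f≗g rewrite f≗g x | count-cong xs f≗g = refl

count-none : ∀ (f : List Pt → Bool) xs → (∀ x → f x ≡ false) → count f xs ≡ 0
count-none f []       none = refl
count-none f (x ∷ xs) none rewrite none x = count-none f xs none

count-∧ˡ : ∀ c (f : List Pt → Bool) xs → count (λ x → c ∧ f x) xs ≡ (if c then count f xs else 0)
count-∧ˡ true  f xs = refl
count-∧ˡ false f xs = count-none _ xs (λ _ → refl)

count-concatMap : ∀ (f : List Pt → Bool) (g : B → List (List Pt)) ys →
  count f (concatMap g ys) ≡ sum (map (count f ∘ g) ys)
count-concatMap f g []       = refl
count-concatMap f g (y ∷ ys) =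
  trans (count-++ f (g y) (concatMap g ys)) (cong (λ s → count f (g y) + s) (count-concatMap f g ys))

_-P_ : Pt → Pt → Pt
(a , b) -P (c , d) = (a ℤ.- c , b ℤ.- d)

==P-sound : ∀ {u v} → (u ==P v) ≡ true → u ≡ v
==P-sound {a , b} {c , d} eq with a ℤ.≟ c | b ℤ.≟ d | eq
... | yes a≡c | yes b≡d | _  = cong₂ _,_ a≡c b≡d
... | yes _   | no _    | ()
... | no _    | _       | ()

_≟P_ : DecidableEquality Pt
_≟P_ = ≡-dec ℤ._≟_ ℤ._≟_

==P-refl : ∀ u → (u ==P u) ≡ true
==P-refl (a , b) = cong₂ _∧_ (dec-true (a ℤ.≟ a) refl) (dec-true (b ℤ.≟ b) refl)

==P-false : ∀ {u v} → u ≢ v → (u ==P v) ≡ false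
==P-false {u} {v} u≢v with u ==P v in eq
... | true  = contradiction (==P-sound eq) u≢v
... | false = refl

+P-cancelʳ : ∀ p s → (p +P s) -P s ≡ p
+P-cancelʳ (a , b) (c , d) = cong₂ _,_ (cancel a c) (cancel b d)
  where
  cancel : ∀ i j → (i ℤ.+ j) ℤ.- j ≡ i
  cancel = solve-∀

-P-cancelʳ : ∀ q s → (q -P s) +P s ≡ q
-P-cancelʳ (a , b) (c , d) = cong₂ _,_ (cancel a c) (cancel b d)
  where
  cancel : ∀ i j → (i ℤ.- j) ℤ.+ j ≡ i
  cancel = solve-∀

if-∧-exchange : ∀ a b c {x : ℕ} →
  (if a ∧ c then (if b ∧ true then x else 0) else 0) ≡ (if b ∧ c then (if a ∧ true then x else 0) else 0)
if-∧-exchange true  true  c = refl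
if-∧-exchange true  false c = if-eta c
if-∧-exchange false true  c = sym (if-eta c)
if-∧-exchange false false c = refl

if-∧-false : ∀ a b {x : ℕ} → (if a then (if b ∧ false then x else 0) else 0) ≡ 0
if-∧-false false b     = refl
if-∧-false true  false = refl
if-∧-false true  true  = refl

module WalkCount (S : List Pt) (okV : Pt → Bool) (okE : Pt → Pt → Bool) where

  okEdges : Pt → List Pt → Bool
  okEdges p []      = true
  okEdges p (s ∷ w) = okE p (p +P s) ∧ okEdges (p +P s) w

  admissible : Pt → Pt → List Pt → Bool
  admissible p q w = (allB okV (vertices p w) ∧ okEdges p w) ∧ (endpoint p w ==P q)

  walks : ℕ → Pt → Pt → ℕ
  walks n p q = count (admissible p q) (allWalks S n)

  admissible-∷ : ∀ p q s w →
    admissible p q (s ∷ w) ≡ (okV p ∧ okE p (p +P s)) ∧ admissible (p +P s) q w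
  admissible-∷ p q s w with okV p | okE p (p +P s)
  ... | false | _     = refl
  ... | true  | true  = refl
  ... | true  | false = cong (_∧ (endpoint (p +P s) w ==P q)) (∧-zeroʳ (allB okV (vertices (p +P s) w)))

  walks-zero : ∀ p q → walks 0 p q ≡ (if okV p ∧ (p ==P q) then 1 else 0)
  walks-zero p q rewrite ∧-identityʳ (okV p) | ∧-identityʳ (okV p) = refl

  walks-suc-first : ∀ n p q → walks (suc n) p q ≡
    sum (map (λ s → if okV p ∧ okE p (p +P s) then walks n (p +P s) q else 0) S)
  walks-suc-first n p q =
    trans (count-concatMap (admissible p q) (λ s → map (s ∷_) (allWalks S n)) S)
          (cong sum (map-cong first-step S))
    where
    first-step : ∀ s → count (admissible p q) (map (s ∷_) (allWalks S n))
                     ≡ (if okV p ∧ okE p (p +P s) then walks n (p +P s) q else 0)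
    first-step s = begin
      count (admissible p q) (map (s ∷_) (allWalks S n))
        ≡⟨ count-map (admissible p q) (s ∷_) (allWalks S n) ⟩
      count (λ w → admissible p q (s ∷ w)) (allWalks S n)
        ≡⟨ count-cong (allWalks S n) (admissible-∷ p q s) ⟩
      count (λ w → (okV p ∧ okE p (p +P s)) ∧ admissible (p +P s) q w) (allWalks S n)
        ≡⟨ count-∧ˡ (okV p ∧ okE p (p +P s)) (admissible (p +P s) q) (allWalks S n) ⟩
      (if okV p ∧ okE p (p +P s) then walks n (p +P s) q else 0) ∎
      where open ≡-Reasoning

  step-reversible : ∀ p q s →
      (if okV p ∧ okE p (p +P s) then (if okV (p +P s) ∧ ((p +P s) ==P q) then 1 else 0) else 0)
    ≡ (if okV q ∧ okE (q -P s) q then (if okV p ∧ (p ==P (q -P s)) then 1 else 0) else 0)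
  step-reversible p q s with (p +P s) ≟P q
  ... | yes refl = begin
    (if okV p ∧ okE p q then (if okV q ∧ (q ==P q) then 1 else 0) else 0)
      ≡⟨ cong (λ e → if okV p ∧ okE p q then (if okV q ∧ e then 1 else 0) else 0) (==P-refl q) ⟩
    (if okV p ∧ okE p q then (if okV q ∧ true then 1 else 0) else 0)
      ≡⟨ if-∧-exchange (okV p) (okV q) (okE p q) ⟩
    (if okV q ∧ okE p q then (if okV p ∧ true then 1 else 0) else 0)
      ≡⟨ cong (λ e → if okV q ∧ okE p q then (if okV p ∧ e then 1 else 0) else 0) (sym (==P-refl p)) ⟩
    (if okV q ∧ okE p q then (if okV p ∧ (p ==P p) then 1 else 0) else 0)
      ≡⟨ cong (λ r → if okV q ∧ okE r q then (if okV p ∧ (p ==P r) then 1 else 0) else 0)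
              (sym (+P-cancelʳ p s)) ⟩
    (if okV q ∧ okE (q -P s) q then (if okV p ∧ (p ==P (q -P s)) then 1 else 0) else 0) ∎
    where open ≡-Reasoning
  ... | no p+s≢q = trans
    (cong (λ e → if okV p ∧ okE p (p +P s) then (if okV (p +P s) ∧ e then 1 else 0) else 0)
          (==P-false p+s≢q))
    (trans (if-∧-false (okV p ∧ okE p (p +P s)) (okV (p +P s)))
      (sym (trans (cong (λ e → if okV q ∧ okE (q -P s) q then (if okV p ∧ e then 1 else 0) else 0)
                        (==P-false {p} {q -P s} λ p≡q-s → p+s≢q (trans (cong (_+P s) p≡q-s) (-P-cancelʳ q s))))
                  (if-∧-false (okV q ∧ okE (q -P s) q) (okV p)))))

  walks-suc-last : ∀ n p q → walks (suc n) p q ≡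
    sum (map (λ s → if okV q ∧ okE (q -P s) q then walks n p (q -P s) else 0) S)
  walks-suc-last zero p q = trans (walks-suc-first 0 p q) (cong sum (map-cong single-step S))
    where
    single-step : ∀ s → (if okV p ∧ okE p (p +P s) then walks 0 (p +P s) q else 0)
                      ≡ (if okV q ∧ okE (q -P s) q then walks 0 p (q -P s) else 0)
    single-step s = begin
      (if okV p ∧ okE p (p +P s) then walks 0 (p +P s) q else 0)
        ≡⟨ cong (λ k → if okV p ∧ okE p (p +P s) then k else 0) (walks-zero (p +P s) q) ⟩
      (if okV p ∧ okE p (p +P s) then (if okV (p +P s) ∧ ((p +P s) ==P q) then 1 else 0) else 0)
        ≡⟨ step-reversible p q s ⟩
      (if okV q ∧ okE (q -P s) q then (if okV p ∧ (p ==P (q -P s)) then 1 else 0) else 0)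
        ≡⟨ cong (λ k → if okV q ∧ okE (q -P s) q then k else 0) (sym (walks-zero p (q -P s))) ⟩
      (if okV q ∧ okE (q -P s) q then walks 0 p (q -P s) else 0) ∎
      where open ≡-Reasoning
  walks-suc-last (suc n) p q = begin
    walks (suc (suc n)) p q
      ≡⟨ walks-suc-first (suc n) p q ⟩
    sum (map (λ s → if first s then walks (suc n) (p +P s) q else 0) S)
      ≡⟨ cong sum (map-cong (λ s → cong (λ k → if first s then k else 0) (walks-suc-last n (p +P s) q)) S) ⟩
    sum (map (λ s → if first s then sum (map (λ s′ → if last s′ then walks n (p +P s) (q -P s′) else 0) S) else 0) S)
      ≡⟨ cong sum (map-cong (λ s → if-sum-map (first s) _ S) S) ⟩
    sum (map (λ s → sum (map (λ s′ → if first s then (if last s′ then walks n (p +P s) (q -P s′) else 0) else 0) S)) S)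
      ≡⟨ sum-map-comm (λ s s′ → if first s then (if last s′ then walks n (p +P s) (q -P s′) else 0) else 0) S S ⟩
    sum (map (λ s′ → sum (map (λ s → if first s then (if last s′ then walks n (p +P s) (q -P s′) else 0) else 0) S)) S)
      ≡⟨ cong sum (map-cong (λ s′ → cong sum (map-cong (λ s → if-swap-then (first s) (last s′)) S)) S) ⟩
    sum (map (λ s′ → sum (map (λ s → if last s′ then (if first s then walks n (p +P s) (q -P s′) else 0) else 0) S)) S)
      ≡⟨ cong sum (map-cong (λ s′ → sym (if-sum-map (last s′) _ S)) S) ⟩
    sum (map (λ s′ → if last s′ then sum (map (λ s → if first s then walks n (p +P s) (q -P s′) else 0) S) else 0) S)
      ≡⟨ cong sum (map-cong (λ s′ → cong (λ k → if last s′ then k else 0) (sym (walks-suc-first n p (q -P s′)))) S) ⟩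
    sum (map (λ s′ → if last s′ then walks (suc n) p (q -P s′) else 0) S) ∎
    where
    open ≡-Reasoning
    first : Pt → Bool
    first s = okV p ∧ okE p (p +P s)
    last : Pt → Bool
    last s′ = okV q ∧ okE (q -P s′) q

  okV-endpoint : ∀ p w → allB okV (vertices p w) ≡ true → okV (endpoint p w) ≡ true
  okV-endpoint p []      all-ok with okV p | all-ok
  ... | true | _ = refl
  okV-endpoint p (s ∷ w) all-ok with okV p | all-ok
  ... | true | rest-ok = okV-endpoint (p +P s) w rest-ok

  admissible-outside : ∀ p q w → okV q ≡ false → admissible p q w ≡ false
  admissible-outside p q w q-bad with endpoint p w ==P q in end≡q
  ... | false = ∧-zeroʳ _
  ... | true with allB okV (vertices p w) in all-ok
  ...   | false = refl
  ...   | true with () ← trans (sym (subst (λ r → okV r ≡ true) (==P-sound end≡q) (okV-endpoint p w all-ok))) q-bad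

  walks-outside : ∀ n p q → okV q ≡ false → walks n p q ≡ 0
  walks-outside n p q q-bad = count-none (admissible p q) (allWalks S n) (λ w → admissible-outside p q w q-bad)

  walks-zero-elsewhere : ∀ {p q} → p ≢ q → walks 0 p q ≡ 0
  walks-zero-elsewhere {p} {q} p≢q =
    trans (walks-zero p q)
          (cong (λ e → if e then 1 else 0) (trans (cong (okV p ∧_) (==P-false p≢q)) (∧-zeroʳ (okV p))))

module C-walks (m : Model) = WalkCount (steps m) inC (λ u v → not (badEdge u v))
module Q-walks (m : Model) = WalkCount (steps m) inQ (λ _ _ → true)

Cwalks : Model → ℕ → Pt → ℕ
Cwalks m n = C-walks.walks m n origin

Qwalks : Model → ℕ → Pt → ℕ
Qwalks m n = Q-walks.walks m n origin

-- i ↦ -2 - i: the coefficient of x^i y^j in x̄² Q(x̄,y) is that of x^(mirror i) y^j in Q.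
mirror : ℤ → ℤ
mirror i = ℤ.- ((i ℤ.+ 1ℤ) ℤ.+ 1ℤ)

reflectX : Pt → Pt
reflectX (i , j) = (mirror i , j)

reflectY : Pt → Pt
reflectY (i , j) = (i , mirror j)

flipX : Pt → Pt
flipX (i , j) = (ℤ.- i , j)

flipY : Pt → Pt
flipY (i , j) = (i , ℤ.- j)

mirror-involutive : ∀ i → mirror (mirror i) ≡ i
mirror-involutive = identity
  where
  identity : ∀ i → ℤ.- ((ℤ.- ((i ℤ.+ 1ℤ) ℤ.+ 1ℤ) ℤ.+ 1ℤ) ℤ.+ 1ℤ) ≡ i
  identity = solve-∀

mirror-+ : ∀ a → mirror (+ a) ≡ -[1+ suc a ]
mirror-+ a = cong (λ k → ℤ.- (+ k)) (trans (ℕ.+-assoc a 1 1) (ℕ.+-comm a 2))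

mirror-minus : ∀ i s → mirror (i ℤ.- s) ≡ mirror i ℤ.- ℤ.- s
mirror-minus = identity
  where
  identity : ∀ i s → ℤ.- (((i ℤ.- s) ℤ.+ 1ℤ) ℤ.+ 1ℤ) ≡ ℤ.- ((i ℤ.+ 1ℤ) ℤ.+ 1ℤ) ℤ.- ℤ.- s
  identity = solve-∀

reflectX-minus : ∀ q s → reflectX (q -P s) ≡ reflectX q -P flipX s
reflectX-minus (i , j) (s , t) = cong (_, j ℤ.- t) (mirror-minus i s)

reflectY-minus : ∀ q s → reflectY (q -P s) ≡ reflectY q -P flipY s
reflectY-minus (i , j) (s , t) = cong (i ℤ.- s ,_) (mirror-minus j t)

rotation-↭ : ∀ k (xs : List A) → drop k xs ++ take k xs ↭ xs
rotation-↭ k xs = ↭-trans (↭.++-comm (drop k xs) (take k xs)) (↭-reflexive (take++drop≡id k xs))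

reverse-rotation⇒map-↭ : ∀ (f : A → A) k xs → reverse (map f xs) ≡ drop k xs ++ take k xs → map f xs ↭ xs
reverse-rotation⇒map-↭ f k xs rev≡rot =
  ↭-trans (↭-sym (↭.↭-reverse (map f xs))) (subst (_↭ xs) (sym rev≡rot) (rotation-↭ k xs))

-- Each step set is listed in counterclockwise order, so a reflection reverses it up to rotation.
flipX-permutes : ∀ m → map flipX (steps m) ↭ steps m
flipX-permutes simple   = reverse-rotation⇒map-↭ flipX 3 _ refl
flipX-permutes diagonal = reverse-rotation⇒map-↭ flipX 2 _ refl
flipX-permutes king     = reverse-rotation⇒map-↭ flipX 5 _ refl
flipX-permutes diabolo  = reverse-rotation⇒map-↭ flipX 4 _ refl

flipY-permutes : ∀ m → map flipY (steps m) ↭ steps m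
flipY-permutes simple   = reverse-rotation⇒map-↭ flipY 1 _ refl
flipY-permutes diagonal = reverse-rotation⇒map-↭ flipY 0 _ refl
flipY-permutes king     = reverse-rotation⇒map-↭ flipY 1 _ refl
flipY-permutes diabolo  = reverse-rotation⇒map-↭ flipY 1 _ refl

UnitStep : Pt → Set
UnitStep (i , j) = i ℤ.≤ 1ℤ × j ℤ.≤ 1ℤ

unitStep? : ∀ s → Dec (UnitStep s)
unitStep? (i , j) = (i ℤ.≤? 1ℤ) ×-dec (j ℤ.≤? 1ℤ)

steps-unit : ∀ m → All UnitStep (steps m)
steps-unit simple   = from-yes (all? unitStep? (steps simple))
steps-unit diagonal = from-yes (all? unitStep? (steps diagonal))
steps-unit king     = from-yes (all? unitStep? (steps king))
steps-unit diabolo  = from-yes (all? unitStep? (steps diabolo))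

badEdge-elsewhere : ∀ u {r} → r ≢ (0ℤ , m1) → r ≢ (m1 , 0ℤ) → badEdge u r ≡ false
badEdge-elsewhere u {r} r≢0,-1 r≢-1,0 = cong₂ _∨_
  (trans (cong ((u ==P (m1 , 0ℤ)) ∧_) (==P-false {r} r≢0,-1)) (∧-zeroʳ _))
  (trans (cong ((u ==P (0ℤ , m1)) ∧_) (==P-false {r} r≢-1,0)) (∧-zeroʳ _))

C-walks-suc : ∀ m n {r} → inC r ≡ true → r ≢ (0ℤ , m1) → r ≢ (m1 , 0ℤ) →
  Cwalks m (suc n) r ≡ sum (map (λ s → Cwalks m n (r -P s)) (steps m))
C-walks-suc m n {r} r∈C r≢0,-1 r≢-1,0 =
  trans (C-walks.walks-suc-last m n origin r) (cong sum (map-cong last-step-allowed (steps m)))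
  where
  last-step-allowed : ∀ s →
    (if inC r ∧ not (badEdge (r -P s) r) then Cwalks m n (r -P s) else 0) ≡ Cwalks m n (r -P s)
  last-step-allowed s = cong (λ b → if b then Cwalks m n (r -P s) else 0)
    (cong₂ (λ x y → x ∧ not y) r∈C (badEdge-elsewhere (r -P s) r≢0,-1 r≢-1,0))

Q-walks-suc : ∀ m n {r} → inQ r ≡ true →
  Qwalks m (suc n) r ≡ sum (map (λ s → Qwalks m n (r -P s)) (steps m))
Q-walks-suc m n {r} r∈Q =
  trans (Q-walks.walks-suc-last m n origin r)
        (cong sum (map-cong (λ s → cong (λ b → if b ∧ true then Qwalks m n (r -P s) else 0) r∈Q) (steps m)))

ReflectionIdentity : Model → ℕ → Pt → Set
ReflectionIdentity m n r = Cwalks m n r ≡ Qwalks m n r + (Cwalks m n (reflectX r) + Cwalks m n (reflectY r))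

nonneg-mirror : ∀ {j} → -1ℤ ℤ.≤ j → nonneg (mirror j) ≡ false
nonneg-mirror { -[1+ 0 ]} _ = refl
nonneg-mirror {+ b}      _ = cong nonneg (mirror-+ b)
nonneg-mirror { -[1+ suc _ ]} (ℤ.-≤- ())

reflection-identity-left : ∀ m n {j} → -1ℤ ℤ.≤ j → ReflectionIdentity m n (-1ℤ , j)
reflection-identity-left m n {j} j≥-1 = sym (trans
  (cong₂ (λ x y → x + (Cwalks m n (-1ℤ , j) + y))
         (Q-walks.walks-outside m n origin (-1ℤ , j) refl)
         (C-walks.walks-outside m n origin (-1ℤ , mirror j) (nonneg-mirror j≥-1)))
  (ℕ.+-identityʳ _))

reflection-identity-below : ∀ m n {i} → -1ℤ ℤ.≤ i → ReflectionIdentity m n (i , -1ℤ)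
reflection-identity-below m n {i} i≥-1 = sym
  (cong₂ (λ x y → x + (y + Cwalks m n (i , -1ℤ)))
         (Q-walks.walks-outside m n origin (i , -1ℤ) (∧-zeroʳ (nonneg i)))
         (C-walks.walks-outside m n origin (mirror i , -1ℤ) (trans (∨-identityʳ _) (nonneg-mirror i≥-1))))

reflectX-+ : ∀ a b → reflectX (+ a , + b) ≡ (-[1+ suc a ] , + b)
reflectX-+ a b = cong (_, + b) (mirror-+ a)

reflectY-+ : ∀ a b → reflectY (+ a , + b) ≡ (+ a , -[1+ suc b ])
reflectY-+ a b = cong (+ a ,_) (mirror-+ b)

-- At length 0 the 𝒞- and 𝒬-counts at q coincide definitionally.
reflection-identity-zero : ∀ m a b → ReflectionIdentity m 0 (+ a , + b)
reflection-identity-zero m a b = sym (trans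
  (cong₂ (λ x y → Qwalks m 0 (+ a , + b) + (x + y))
         (C-walks.walks-zero-elsewhere m {origin} {reflectX (+ a , + b)} λ eq → case trans eq (reflectX-+ a b) of λ ())
         (C-walks.walks-zero-elsewhere m {origin} {reflectY (+ a , + b)} λ eq → case trans eq (reflectY-+ a b) of λ ()))
  (ℕ.+-identityʳ _))

C-walks-suc-reflected : ∀ m n {q} (ρ φ : Pt → Pt) → map φ (steps m) ↭ steps m →
  (∀ s → ρ (q -P s) ≡ ρ q -P φ s) →
  inC (ρ q) ≡ true → ρ q ≢ (0ℤ , m1) → ρ q ≢ (m1 , 0ℤ) →
  Cwalks m (suc n) (ρ q) ≡ sum (map (λ s → Cwalks m n (ρ (q -P s))) (steps m))
C-walks-suc-reflected m n {q} ρ φ φ-permutes ρ-minus ρq∈C ρq≢0,-1 ρq≢-1,0 = begin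
  Cwalks m (suc n) (ρ q)
    ≡⟨ C-walks-suc m n ρq∈C ρq≢0,-1 ρq≢-1,0 ⟩
  sum (map (λ s → Cwalks m n (ρ q -P s)) (steps m))
    ≡⟨ sum-map-invariant φ (λ s → Cwalks m n (ρ q -P s)) (steps m) φ-permutes ⟨
  sum (map (λ s → Cwalks m n (ρ q -P φ s)) (steps m))
    ≡⟨ cong sum (map-cong (λ s → cong (Cwalks m n) (ρ-minus s)) (steps m)) ⟨
  sum (map (λ s → Cwalks m n (ρ (q -P s))) (steps m)) ∎
  where open ≡-Reasoning

reflection-identity-suc : ∀ m n a b →
  All (λ s → ReflectionIdentity m n ((+ a , + b) -P s)) (steps m) →
  ReflectionIdentity m (suc n) (+ a , + b)
reflection-identity-suc m n a b ih = begin
  C (suc n) q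
    ≡⟨ C-walks-suc m n refl (λ ()) (λ ()) ⟩
  sum (map (λ s → C n (q -P s)) S)
    ≡⟨ cong sum (map-cong-local ih) ⟩
  sum (map (λ s → Q n (q -P s) + (C n (reflectX (q -P s)) + C n (reflectY (q -P s)))) S)
    ≡⟨ sum-map-+ (λ s → Q n (q -P s)) _ S ⟩
  sum (map (λ s → Q n (q -P s)) S) + sum (map (λ s → C n (reflectX (q -P s)) + C n (reflectY (q -P s))) S)
    ≡⟨ cong (λ k → sum (map (λ s → Q n (q -P s)) S) + k) (sum-map-+ (λ s → C n (reflectX (q -P s))) _ S) ⟩
  sum (map (λ s → Q n (q -P s)) S) + (sum (map (λ s → C n (reflectX (q -P s))) S) + sum (map (λ s → C n (reflectY (q -P s))) S))
    ≡⟨ cong₂ _+_ (Q-walks-suc m n refl) (cong₂ _+_ reflectX-suc reflectY-suc) ⟨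
  Q (suc n) q + (C (suc n) (reflectX q) + C (suc n) (reflectY q)) ∎
  where
  open ≡-Reasoning
  S = steps m
  q = (+ a , + b)
  C = Cwalks m
  Q = Qwalks m
  reflectX-suc : C (suc n) (reflectX q) ≡ sum (map (λ s → C n (reflectX (q -P s))) S)
  reflectX-suc = C-walks-suc-reflected m n {q} reflectX flipX (flipX-permutes m) (reflectX-minus q)
    (cong inC (reflectX-+ a b))
    (λ eq → case trans (sym (reflectX-+ a b)) eq of λ ())
    (λ eq → case trans (sym (reflectX-+ a b)) eq of λ ())
  reflectY-suc : C (suc n) (reflectY q) ≡ sum (map (λ s → C n (reflectY (q -P s))) S)
  reflectY-suc = C-walks-suc-reflected m n {q} reflectY flipY (flipY-permutes m) (reflectY-minus q)
    (cong inC (reflectY-+ a b))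
    (λ eq → case trans (sym (reflectY-+ a b)) eq of λ ())
    (λ eq → case trans (sym (reflectY-+ a b)) eq of λ ())

minus-unit-step : ∀ a {i} → i ℤ.≤ 1ℤ → -1ℤ ℤ.≤ + a ℤ.- i
minus-unit-step a i≤1 = ℤ.+-mono-≤ (ℤ.+≤+ ℕ.z≤n) (ℤ.neg-mono-≤ i≤1)

reflection-identity : ∀ m n {i j} → -1ℤ ℤ.≤ i → -1ℤ ℤ.≤ j → ReflectionIdentity m n (i , j)
reflection-identity m n       { -[1+ 0 ]}          _    j≥-1 = reflection-identity-left m n j≥-1
reflection-identity m n       {+ a} { -[1+ 0 ]}    i≥-1 _    = reflection-identity-below m n i≥-1
reflection-identity m zero    {+ a} {+ b}          _    _    = reflection-identity-zero m a b
reflection-identity m (suc n) {+ a} {+ b}          _    _    = reflection-identity-suc m n a b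
  (All.map (λ (s₁≤1 , s₂≤1) → reflection-identity m n (minus-unit-step a s₁≤1) (minus-unit-step b s₂≤1))
           (steps-unit m))
reflection-identity m n       { -[1+ suc _ ]}      (ℤ.-≤- ()) _
reflection-identity m n       {+ a} { -[1+ suc _ ]} _   (ℤ.-≤- ())

noBadEdge≡okEdges : ∀ m p w → noBadEdge p w ≡ C-walks.okEdges m p w
noBadEdge≡okEdges m p []      = refl
noBadEdge≡okEdges m p (s ∷ w) = cong (not (badEdge p (p +P s)) ∧_) (noBadEdge≡okEdges m (p +P s) w)

okEdges-Q : ∀ m p w → Q-walks.okEdges m p w ≡ true
okEdges-Q m p []      = refl
okEdges-Q m p (s ∷ w) = okEdges-Q m (p +P s) w

count-C≡Cwalks : ∀ m n r →
  count (λ w → confinedC w ∧ (endpoint origin w ==P r)) (allWalks (steps m) n) ≡ Cwalks m n r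
count-C≡Cwalks m n r = count-cong (allWalks (steps m) n) λ w →
  cong (λ e → (allB inC (vertices origin w) ∧ e) ∧ (endpoint origin w ==P r)) (noBadEdge≡okEdges m origin w)

count-Q≡Qwalks : ∀ m n r →
  count (λ w → confinedQ w ∧ (endpoint origin w ==P r)) (allWalks (steps m) n) ≡ Qwalks m n r
count-Q≡Qwalks m n r = count-cong (allWalks (steps m) n) λ w →
  cong (_∧ (endpoint origin w ==P r))
       (sym (trans (cong (allB inQ (vertices origin w) ∧_) (okEdges-Q m origin w)) (∧-identityʳ _)))

natℚ-+ : ∀ a b → natℚ (a + b) ≡ natℚ a ℚ.+ natℚ b
natℚ-+ a b = trans (natℚ-mkℚ (a + b)) (trans
  (ℚ.toℚᵘ-injective (ℚᵘ.≃-trans (ℚᵘ.*≡* (+-homo (+ a) (+ b)))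
                                  (ℚᵘ.≃-sym (ℚ.toℚᵘ-homo-+ (mkℚ (+ a) 0 (coprime-1 a)) (mkℚ (+ b) 0 (coprime-1 b))))))
  (sym (cong₂ ℚ._+_ (natℚ-mkℚ a) (natℚ-mkℚ b))))
  where
  coprime-1 : ∀ k → Coprime.Coprime k 1
  coprime-1 k = Coprime.sym (Coprime.1-coprimeTo k)
  natℚ-mkℚ : ∀ k → natℚ k ≡ mkℚ (+ k) 0 (coprime-1 k)
  natℚ-mkℚ k = ℚ.normalize-coprime (coprime-1 k)
  +-homo : ∀ x y → (x ℤ.+ y) ℤ.* + 1 ≡ (x ℤ.* + 1 ℤ.+ y ℤ.* + 1) ℤ.* + 1
  +-homo = solve-∀

⅓ : ℚ
⅓ = + 1 ℚ./ 3

A-formula : ℕ → ℕ → ℕ → ℕ → ℚ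
A-formula c q qx qy = natℚ c ℚ.- ⅓ ℚ.* ((natℚ q ℚ.- natℚ qx) ℚ.- natℚ qy)

Aser≡A-formula : ∀ m n i j → Aser m n i j ≡
  A-formula (Cwalks m n (i , j)) (Qwalks m n (i , j)) (Qwalks m n (reflectX (i , j))) (Qwalks m n (reflectY (i , j)))
Aser≡A-formula m n i j =
  cong₂ (λ c (q , qx , qy) → A-formula c q qx qy) (count-C≡Cwalks m n (i , j))
        (cong₂ _,_ (count-Q≡Qwalks m n (i , j)) (cong₂ _,_ (count-Q≡Qwalks m n _) (count-Q≡Qwalks m n _)))

A-formula-split : ∀ q c₁ c₂ → A-formula (q + (c₁ + c₂)) q 0 0 ≡ A-formula c₁ 0 q 0 ℚ.+ A-formula c₂ 0 0 q
A-formula-split q c₁ c₂ = begin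
  natℚ (q + (c₁ + c₂)) ℚ.- ⅓ ℚ.* ((X ℚ.- 0ℚ) ℚ.- 0ℚ)
    ≡⟨ cong (λ x → x ℚ.- ⅓ ℚ.* ((X ℚ.- 0ℚ) ℚ.- 0ℚ)) (trans (natℚ-+ q (c₁ + c₂)) (cong (X ℚ.+_) (natℚ-+ c₁ c₂))) ⟩
  (X ℚ.+ (Y ℚ.+ Z)) ℚ.- ⅓ ℚ.* ((X ℚ.- 0ℚ) ℚ.- 0ℚ)
    ≡⟨ identity X Y Z ⅓ ⟩
  R ℚ.+ (X ℚ.- ((⅓ ℚ.+ ⅓) ℚ.+ ⅓) ℚ.* X)
    -- the closed term (⅓ ℚ.+ ⅓) ℚ.+ ⅓ evaluates to 1ℚ
    ≡⟨ cong (λ x → R ℚ.+ (X ℚ.- x)) (ℚ.*-identityˡ X) ⟩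
  R ℚ.+ (X ℚ.- X)
    ≡⟨ trans (cong (R ℚ.+_) (ℚ.+-inverseʳ X)) (ℚ.+-identityʳ R) ⟩
  R ∎
  where
  open ≡-Reasoning
  X = natℚ q
  Y = natℚ c₁
  Z = natℚ c₂
  R = (Y ℚ.- ⅓ ℚ.* ((0ℚ ℚ.- X) ℚ.- 0ℚ)) ℚ.+ (Z ℚ.- ⅓ ℚ.* ((0ℚ ℚ.- 0ℚ) ℚ.- X))
  identity : ∀ X Y Z t →
    (X ℚ.+ (Y ℚ.+ Z)) ℚ.- t ℚ.* ((X ℚ.- 0ℚ) ℚ.- 0ℚ)
      ≡ ((Y ℚ.- t ℚ.* ((0ℚ ℚ.- X) ℚ.- 0ℚ)) ℚ.+ (Z ℚ.- t ℚ.* ((0ℚ ℚ.- 0ℚ) ℚ.- X))) ℚ.+ (X ℚ.- ((t ℚ.+ t) ℚ.+ t) ℚ.* X)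
  identity = solve 4 (λ X Y Z t →
    (X :+ (Y :+ Z)) :- t :* ((X :- con 0ℚ) :- con 0ℚ)
      := ((Y :- t :* ((con 0ℚ :- X) :- con 0ℚ)) :+ (Z :- t :* ((con 0ℚ :- con 0ℚ) :- X))) :+ (X :- ((t :+ t) :+ t) :* X)) refl
    where open +-*-Solver

A-reflection : ∀ m n a b → Aser m n (+ a) (+ b) ≡ Aser m n (mirror (+ a)) (+ b) ℚ.+ Aser m n (+ a) (mirror (+ b))
A-reflection m n a b = begin
  Aser m n (+ a) (+ b)
    ≡⟨ Aser≡A-formula m n (+ a) (+ b) ⟩
  A-formula (C q) (Q q) (Q (reflectX q)) (Q (reflectY q))
    ≡⟨ cong₂ (λ c (qx , qy) → A-formula c (Q q) qx qy)
             (reflection-identity m n ℤ.-≤+ ℤ.-≤+)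
             (cong₂ _,_ (Q-outside (cong (_∧ true) mirror-a<0)) (Q-outside mirror-b<0)) ⟩
  A-formula (Q q + (C (reflectX q) + C (reflectY q))) (Q q) 0 0
    ≡⟨ A-formula-split (Q q) (C (reflectX q)) (C (reflectY q)) ⟩
  A-formula (C (reflectX q)) 0 (Q q) 0 ℚ.+ A-formula (C (reflectY q)) 0 0 (Q q)
    ≡⟨ cong₂ ℚ._+_ A-left A-below ⟨
  Aser m n (mirror (+ a)) (+ b) ℚ.+ Aser m n (+ a) (mirror (+ b)) ∎
  where
  open ≡-Reasoning
  q = (+ a , + b)
  C = Cwalks m n
  Q = Qwalks m n
  Q-outside : ∀ {r} → inQ r ≡ false → Q r ≡ 0
  Q-outside {r} = Q-walks.walks-outside m n origin r
  mirror-a<0 : nonneg (mirror (+ a)) ≡ false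
  mirror-a<0 = nonneg-mirror {+ a} ℤ.-≤+
  mirror-b<0 : nonneg (mirror (+ b)) ≡ false
  mirror-b<0 = nonneg-mirror {+ b} ℤ.-≤+
  A-left : Aser m n (mirror (+ a)) (+ b) ≡ A-formula (C (reflectX q)) 0 (Q q) 0
  A-left = trans (Aser≡A-formula m n (mirror (+ a)) (+ b))
    (cong₂ (λ (q₀ , qy) qx → A-formula (C (reflectX q)) q₀ qx qy)
           (cong₂ _,_ (Q-outside (cong (_∧ true) mirror-a<0))
                      (Q-outside (cong (_∧ nonneg (mirror (+ b))) mirror-a<0)))
           (cong (λ i → Q (i , + b)) (mirror-involutive (+ a))))
  A-below : Aser m n (+ a) (mirror (+ b)) ≡ A-formula (C (reflectY q)) 0 0 (Q q)
  A-below = trans (Aser≡A-formula m n (+ a) (mirror (+ b)))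
    (cong₂ (λ (q₀ , qx) qy → A-formula (C (reflectY q)) q₀ qx qy)
           (cong₂ _,_ (Q-outside mirror-b<0)
                      (Q-outside (cong (_∧ nonneg (mirror (+ b))) mirror-a<0)))
           (cong (λ j → Q (+ a , j)) (mirror-involutive (+ b))))

pos-+1 : ∀ a → + a ℤ.+ 1ℤ ≡ + suc a
pos-+1 a = cong +_ (ℕ.+-comm a 1)

neg-+1 : ∀ a → ℤ.- (+ a ℤ.+ 1ℤ) ≡ -[1+ a ]
neg-+1 a = cong ℤ.-_ (pos-+1 a)

shiftX : Series → Series
shiftX F n a b = F n (suc a) b

shiftY : Series → Series
shiftY F n a b = F n a (suc b)

module _ {m : Model} {P L B : Series} (decomposition : IsDecomposition m P L B) where

  A-on-quadrant : ∀ n a b → Aser m n (+ a) (+ b) ≡ P n a b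
  A-on-quadrant n a b = trans (decomposition n (+ a) (+ b))
    (trans (cong₂ (λ i j → (P n a b ℚ.+ embed L n i (+ b)) ℚ.+ embed B n (+ a) j) (neg-+1 a) (neg-+1 b))
           (trans (ℚ.+-identityʳ _) (ℚ.+-identityʳ _)))

  A-on-reflectX : ∀ n a b → Aser m n (mirror (+ a)) (+ b) ≡ L n (suc a) b
  A-on-reflectX n a b = trans (cong (λ i → Aser m n i (+ b)) (mirror-+ a))
    (trans (decomposition n -[1+ suc a ] (+ b))
           (trans (ℚ.+-identityʳ _) (ℚ.+-identityˡ _)))

  A-on-reflectY : ∀ n a b → Aser m n (+ a) (mirror (+ b)) ≡ B n a (suc b)
  A-on-reflectY n a b = trans (cong (Aser m n (+ a)) (mirror-+ b))
    (trans (decomposition n (+ a) -[1+ suc b ])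
           (trans (cong (λ i → (0ℚ ℚ.+ embed L n i -[1+ suc b ]) ℚ.+ B n a (suc b)) (neg-+1 a))
                  (ℚ.+-identityˡ _)))

  P≡shiftX+shiftY : ∀ n a b → P n a b ≡ shiftX L n a b ℚ.+ shiftY B n a b
  P≡shiftX+shiftY n a b = begin
    P n a b                                                           ≡⟨ A-on-quadrant n a b ⟨
    Aser m n (+ a) (+ b)                                              ≡⟨ A-reflection m n a b ⟩
    Aser m n (mirror (+ a)) (+ b) ℚ.+ Aser m n (+ a) (mirror (+ b))  ≡⟨ cong₂ ℚ._+_ (A-on-reflectX n a b) (A-on-reflectY n a b) ⟩
    L n (suc a) b ℚ.+ B n a (suc b)                                   ∎
    where open ≡-Reasoning

xbar-remainder : ∀ F → xbar· (embed F ⊖ atX0 (embed F)) ≈S embed (shiftX F)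
xbar-remainder F n (+ a)        (+ b)    = trans (cong (λ i → embed F n i (+ b) ℚ.- atX0 (embed F) n i (+ b)) (pos-+1 a))
                                                 (ℚ.+-identityʳ _)
xbar-remainder F n (+ a)        -[1+ k ] = trans (cong (λ i → embed F n i -[1+ k ] ℚ.- atX0 (embed F) n i -[1+ k ]) (pos-+1 a))
                                                 (ℚ.+-identityʳ _)
xbar-remainder F n -[1+ 0 ]     j        = ℚ.+-inverseʳ (embed F n 0ℤ j)
xbar-remainder F n -[1+ suc _ ] j        = refl

ybar-remainder : ∀ F → ybar· (embed F ⊖ atY0 (embed F)) ≈S embed (shiftY F)
ybar-remainder F n (+ a)    (+ b)        = trans (cong (λ j → embed F n (+ a) j ℚ.- atY0 (embed F) n (+ a) j) (pos-+1 b))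
                                                 (ℚ.+-identityʳ _)
ybar-remainder F n -[1+ k ] (+ b)        = trans (cong (λ j → embed F n -[1+ k ] j ℚ.- atY0 (embed F) n -[1+ k ] j) (pos-+1 b))
                                                 (ℚ.+-identityʳ _)
ybar-remainder F n (+ a)    -[1+ 0 ]     = ℚ.+-inverseʳ (embed F n (+ a) 0ℤ)
ybar-remainder F n -[1+ _ ] -[1+ 0 ]     = refl
ybar-remainder F n (+ _)    -[1+ suc _ ] = refl
ybar-remainder F n -[1+ _ ] -[1+ suc _ ] = refl

corollary13 : (m : Model) (P L B : Series) → IsDecomposition m P L B →
    embed P ≈S (xbar· (embed L ⊖ atX0 (embed L)) ⊕ ybar· (embed B ⊖ atY0 (embed B)))
corollary13 m P L B decomposition n i j = begin
  embed P n i j                                           ≡⟨ P-split i j ⟩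
  embed (shiftX L) n i j ℚ.+ embed (shiftY B) n i j       ≡⟨ cong₂ ℚ._+_ (xbar-remainder L n i j) (ybar-remainder B n i j) ⟨
  (xbar· (embed L ⊖ atX0 (embed L)) ⊕ ybar· (embed B ⊖ atY0 (embed B))) n i j ∎
  where
  open ≡-Reasoning
  P-split : ∀ i j → embed P n i j ≡ embed (shiftX L) n i j ℚ.+ embed (shiftY B) n i j
  P-split (+ a)    (+ b)    = P≡shiftX+shiftY decomposition n a b
  P-split (+ a)    -[1+ _ ] = refl
  P-split -[1+ _ ] j        = refl
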